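{- Let IPC be presented as the Hilbert-style logic over the language $\{\land,\lor,\longrightarrow,\neg,0,1\}$ with axiom schemes (A1)–(A10) below and the single rule modus ponens $\frac{\alpha,\ \alpha\longrightarrow\beta}{\beta}$. Then the left variable inclusion companion of IPC coincides with its restricted rules companion, i.e. the Hilbert-style logic with axioms (A1)–(A10) and the single rule $\frac{\alpha,\ \alpha\longrightarrow\beta}{\beta}$ provided $\mathrm{var}(\alpha)\subseteq\mathrm{var}(\beta)$ has the same consequence relation as $\vdash_{\mathrm{IPC}}^l$. The axioms are: (A1) $\alpha\longrightarrow(\beta\longrightarrow\alpha)$; (A2) $(\alpha\longrightarrow(\beta\longrightarrow\gamma))\longrightarrow((\alpha\longrightarrow\beta)\longrightarrow(\alpha\longrightarrow\gamma))$; (A3) $\alpha\longrightarrow(\beta\longrightarrow(\alpha\land\beta))$; (A4) $\alpha\land\beta\longrightarrow\alpha$; (A5) $\alpha\land\beta\longrightarrow\beta$; (A6) $\alpha\longrightarrow\alpha\lor\beta$; (A7) $\beta\longrightarrow\alpha\lor\beta$; (A8) $(\alpha\longrightarrow\gamma)\longrightarrow((\beta\longrightarrow\gamma)\longrightarrow(\alpha\lor\beta\longrightarrow\gamma))$; (A9) $(\alpha\longrightarrow\beta)\longrightarrow((\alpha\longrightarrow\neg\beta)\longrightarrow\neg\alpha)$; (A10) $0\longrightarrow\alpha$.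
   Context: Formulas are built over a countably infinite set $V$ of variables with connectives $\land,\lor,\longrightarrow$ (binary), $\neg$ (unary), $0,1$ (constants); $\mathit{Fm}$ is the set of formulas. In a Hilbert-style logic, $\Sigma\vdash\varphi$ iff there is a finite sequence ending in $\varphi$ each member of which is an instance of an axiom, a member of $\Sigma$, or obtained from earlier members by a rule. $\mathrm{var}(\varphi)$ is the set of variables of $\varphi$, $\mathrm{var}(\Gamma)=\bigcup_{\gamma\in\Gamma}\mathrm{var}(\gamma)$. The left variable inclusion companion $\vdash^l_{\mathrm{IPC}}$: $\Gamma\vdash^l_{\mathrm{IPC}}\varphi$ iff there is $\Gamma'\subseteq\Gamma$ with $\mathrm{var}(\Gamma')\subseteq\mathrm{var}(\varphi)$ and $\Gamma'\vdash_{\mathrm{IPC}}\varphi$. The restricted rules companion keeps the axioms and restricts each rule $\frac{\Gamma}{\alpha}$ to instances with $\mathrm{var}(\Gamma)\subseteq\mathrm{var}(\alpha)$. -}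

module Defs where

open import Data.Nat using (ℕ)
open import Level using (Level; suc; _⊔_)
open import Data.Product using (Σ; _×_)
open import Relation.Binary.PropositionalEquality using (_≡_)

Var : Set
Var = ℕ

data Fm : Set where
  var  : Var → Fm
  _∧_  : Fm → Fm → Fm
  _∨_  : Fm → Fm → Fm
  _⟶_  : Fm → Fm → Fm
  ¬_   : Fm → Fm
  𝟘    : Fm
  𝟙    : Fm

infixr 6 _∧_
infixr 5 _∨_
infixr 4 _⟶_
infix 7 ¬_

data _occursIn_ (x : Var) : Fm → Set where
  here : x occursIn var x
  ∧ˡ : ∀ {a b} → x occursIn a → x occursIn (a ∧ b)
  ∧ʳ : ∀ {a b} → x occursIn b → x occursIn (a ∧ b)
  ∨ˡ : ∀ {a b} → x occursIn a → x occursIn (a ∨ b)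
  ∨ʳ : ∀ {a b} → x occursIn b → x occursIn (a ∨ b)
  ⟶ˡ : ∀ {a b} → x occursIn a → x occursIn (a ⟶ b)
  ⟶ʳ : ∀ {a b} → x occursIn b → x occursIn (a ⟶ b)
  ¬′ : ∀ {a} → x occursIn a → x occursIn (¬ a)

FmSet : Set₁
FmSet = Fm → Set

_⊆_ : FmSet → FmSet → Set
Γ ⊆ Δ = ∀ {φ} → Γ φ → Δ φ

_varSub_ : Fm → Fm → Set
φ varSub ψ = ∀ {x} → x occursIn φ → x occursIn ψ

_varSetSub_ : FmSet → Fm → Set
Γ varSetSub φ = ∀ {γ x} → Γ γ → x occursIn γ → x occursIn φ

data Axiom : Fm → Set where
  A1  : ∀ a b → Axiom (a ⟶ (b ⟶ a))
  A2  : ∀ a b c → Axiom ((a ⟶ (b ⟶ c)) ⟶ ((a ⟶ b) ⟶ (a ⟶ c)))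
  A3  : ∀ a b → Axiom (a ⟶ (b ⟶ (a ∧ b)))
  A4  : ∀ a b → Axiom ((a ∧ b) ⟶ a)
  A5  : ∀ a b → Axiom ((a ∧ b) ⟶ b)
  A6  : ∀ a b → Axiom (a ⟶ (a ∨ b))
  A7  : ∀ a b → Axiom (b ⟶ (a ∨ b))
  A8  : ∀ a b c → Axiom ((a ⟶ c) ⟶ ((b ⟶ c) ⟶ ((a ∨ b) ⟶ c)))
  A9  : ∀ a b → Axiom ((a ⟶ b) ⟶ ((a ⟶ ¬ b) ⟶ ¬ a))
  A10 : ∀ a → Axiom (𝟘 ⟶ a)

-- Derivability in IPC (Hilbert calculus, rule: modus ponens).
-- Derivation trees; equivalent to the finite-sequence definition.
data _⊢_ (Γ : FmSet) : Fm → Set where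
  ax  : ∀ {φ} → Axiom φ → Γ ⊢ φ
  hyp : ∀ {φ} → Γ φ → Γ ⊢ φ
  mp  : ∀ {α β} → Γ ⊢ α → Γ ⊢ (α ⟶ β) → Γ ⊢ β

-- Restricted rules companion: modus ponens only when var(α) ∪ var(α ⟶ β) ⊆ var(β),
-- i.e. var(α) ⊆ var(β).
data _⊢ʳ_ (Γ : FmSet) : Fm → Set where
  ax  : ∀ {φ} → Axiom φ → Γ ⊢ʳ φ
  hyp : ∀ {φ} → Γ φ → Γ ⊢ʳ φ
  mp  : ∀ {α β} → α varSub β → Γ ⊢ʳ α → Γ ⊢ʳ (α ⟶ β) → Γ ⊢ʳ β

_⊢ˡ_ : FmSet → Fm → Set₁
Γ ⊢ˡ φ = Σ FmSet (λ Γ′ → (Γ′ ⊆ Γ) × (Γ′ varSetSub φ) × (Γ′ ⊢ φ))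

infix 3 _⊢_ _⊢ʳ_ _⊢ˡ_

{-# OPTIONS --safe #-}
module Submission where

open import Defs
open import Data.Product using (_×_; Σ; _,_; proj₁; proj₂)
open import Data.Nat using (_≟_)
open import Data.List using (List; []; _∷_; _++_)
open import Data.List.Relation.Unary.All as All using (All; []; _∷_)
open import Data.List.Relation.Unary.All.Properties using (++⁺)
open import Data.List.Relation.Unary.Any using (here; there)
open import Data.List.Membership.Propositional using (_∈_)
open import Data.List.Membership.Propositional.Properties using (∈-++⁺ˡ; ∈-++⁺ʳ)
open import Relation.Nullary using (Dec; yes; no)
open import Relation.Unary using (∅)
open import Relation.Binary.PropositionalEquality using (_≡_; refl; cong; cong₂; subst)

-- If every hypothesis has its variables among those of φ, then a Γ-derivation of φ
-- yields an IPC theorem γ₁ ⟶ … ⟶ γₙ ⟶ φ by the deduction theorem. Every IPC theorem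
-- has a restricted derivation: at a modus ponens step from α and α ⟶ β, substitute 𝟙
-- for the variables of α not occurring in β; this fixes β, turns α into a formula over
-- var(β), and theorems are closed under substitution. The hypotheses γᵢ are then
-- discharged by restricted modus ponens. Conversely, in a restricted derivation every
-- formula, hence every hypothesis used, has its variables among those of the conclusion.

_↾_ : FmSet → Fm → FmSet
(Γ ↾ φ) γ = Γ γ × γ varSub φ

⊢-mono : ∀ {Δ Γ φ} → Δ ⊆ Γ → Δ ⊢ φ → Γ ⊢ φ
⊢-mono Δ⊆Γ (ax a)      = ax a
⊢-mono Δ⊆Γ (hyp h)     = hyp (Δ⊆Γ h)
⊢-mono Δ⊆Γ (mp d₁ d₂)  = mp (⊢-mono Δ⊆Γ d₁) (⊢-mono Δ⊆Γ d₂)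

⊢ʳ-mono : ∀ {Δ Γ φ} → Δ ⊆ Γ → Δ ⊢ʳ φ → Γ ⊢ʳ φ
⊢ʳ-mono Δ⊆Γ (ax a)        = ax a
⊢ʳ-mono Δ⊆Γ (hyp h)       = hyp (Δ⊆Γ h)
⊢ʳ-mono Δ⊆Γ (mp s d₁ d₂)  = mp s (⊢ʳ-mono Δ⊆Γ d₁) (⊢ʳ-mono Δ⊆Γ d₂)

⊢ʳ⇒⊢ : ∀ {Γ φ} → Γ ⊢ʳ φ → Γ ⊢ φ
⊢ʳ⇒⊢ (ax a)        = ax a
⊢ʳ⇒⊢ (hyp h)       = hyp h
⊢ʳ⇒⊢ (mp _ d₁ d₂)  = mp (⊢ʳ⇒⊢ d₁) (⊢ʳ⇒⊢ d₂)

⊢ʳ-↾ : ∀ {Γ ψ φ} → Γ ⊢ʳ ψ → ψ varSub φ → Γ ↾ φ ⊢ʳ ψ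
⊢ʳ-↾         (ax a)               ψ⊆φ = ax a
⊢ʳ-↾         (hyp h)              ψ⊆φ = hyp (h , ψ⊆φ)
⊢ʳ-↾ {φ = φ} (mp {α} {β} s d₁ d₂) β⊆φ = mp s (⊢ʳ-↾ d₁ (λ p → β⊆φ (s p))) (⊢ʳ-↾ d₂ α⟶β⊆φ)
  where
  α⟶β⊆φ : (α ⟶ β) varSub φ
  α⟶β⊆φ (⟶ˡ p) = β⊆φ (s p)
  α⟶β⊆φ (⟶ʳ p) = β⊆φ p

_occursIn?_ : ∀ x φ → Dec (x occursIn φ)
x occursIn? var y with x ≟ y
... | yes refl = yes here
... | no x≢y   = no λ { here → x≢y refl }
x occursIn? (a ∧ b) with x occursIn? a | x occursIn? b
... | yes p | _     = yes (∧ˡ p)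
... | no _  | yes q = yes (∧ʳ q)
... | no p  | no q  = no λ { (∧ˡ r) → p r ; (∧ʳ r) → q r }
x occursIn? (a ∨ b) with x occursIn? a | x occursIn? b
... | yes p | _     = yes (∨ˡ p)
... | no _  | yes q = yes (∨ʳ q)
... | no p  | no q  = no λ { (∨ˡ r) → p r ; (∨ʳ r) → q r }
x occursIn? (a ⟶ b) with x occursIn? a | x occursIn? b
... | yes p | _     = yes (⟶ˡ p)
... | no _  | yes q = yes (⟶ʳ q)
... | no p  | no q  = no λ { (⟶ˡ r) → p r ; (⟶ʳ r) → q r }
x occursIn? (¬ a) with x occursIn? a
... | yes p = yes (¬′ p)
... | no p  = no λ { (¬′ r) → p r }
x occursIn? 𝟘 = no λ ()
x occursIn? 𝟙 = no λ ()

Subst : Set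
Subst = Var → Fm

sub : Subst → Fm → Fm
sub σ (var x) = σ x
sub σ (a ∧ b) = sub σ a ∧ sub σ b
sub σ (a ∨ b) = sub σ a ∨ sub σ b
sub σ (a ⟶ b) = sub σ a ⟶ sub σ b
sub σ (¬ a)   = ¬ sub σ a
sub σ 𝟘       = 𝟘
sub σ 𝟙       = 𝟙

Axiom-sub : ∀ σ {φ} → Axiom φ → Axiom (sub σ φ)
Axiom-sub σ (A1 a b)    = A1 _ _
Axiom-sub σ (A2 a b c)  = A2 _ _ _
Axiom-sub σ (A3 a b)    = A3 _ _
Axiom-sub σ (A4 a b)    = A4 _ _
Axiom-sub σ (A5 a b)    = A5 _ _
Axiom-sub σ (A6 a b)    = A6 _ _
Axiom-sub σ (A7 a b)    = A7 _ _
Axiom-sub σ (A8 a b c)  = A8 _ _ _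
Axiom-sub σ (A9 a b)    = A9 _ _
Axiom-sub σ (A10 a)     = A10 _

occursIn-sub⁻ : ∀ σ φ {x} → x occursIn sub σ φ → Σ Var λ y → y occursIn φ × x occursIn σ y
occursIn-sub⁻ σ (var y) p = y , here , p
occursIn-sub⁻ σ (a ∧ b) (∧ˡ p) with occursIn-sub⁻ σ a p
... | y , q , r = y , ∧ˡ q , r
occursIn-sub⁻ σ (a ∧ b) (∧ʳ p) with occursIn-sub⁻ σ b p
... | y , q , r = y , ∧ʳ q , r
occursIn-sub⁻ σ (a ∨ b) (∨ˡ p) with occursIn-sub⁻ σ a p
... | y , q , r = y , ∨ˡ q , r
occursIn-sub⁻ σ (a ∨ b) (∨ʳ p) with occursIn-sub⁻ σ b p
... | y , q , r = y , ∨ʳ q , r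
occursIn-sub⁻ σ (a ⟶ b) (⟶ˡ p) with occursIn-sub⁻ σ a p
... | y , q , r = y , ⟶ˡ q , r
occursIn-sub⁻ σ (a ⟶ b) (⟶ʳ p) with occursIn-sub⁻ σ b p
... | y , q , r = y , ⟶ʳ q , r
occursIn-sub⁻ σ (¬ a) (¬′ p) with occursIn-sub⁻ σ a p
... | y , q , r = y , ¬′ q , r

occursIn-sub⁺ : ∀ σ φ {x y} → y occursIn φ → x occursIn σ y → x occursIn sub σ φ
occursIn-sub⁺ σ (var _) here   r = r
occursIn-sub⁺ σ (a ∧ b) (∧ˡ q) r = ∧ˡ (occursIn-sub⁺ σ a q r)
occursIn-sub⁺ σ (a ∧ b) (∧ʳ q) r = ∧ʳ (occursIn-sub⁺ σ b q r)
occursIn-sub⁺ σ (a ∨ b) (∨ˡ q) r = ∨ˡ (occursIn-sub⁺ σ a q r)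
occursIn-sub⁺ σ (a ∨ b) (∨ʳ q) r = ∨ʳ (occursIn-sub⁺ σ b q r)
occursIn-sub⁺ σ (a ⟶ b) (⟶ˡ q) r = ⟶ˡ (occursIn-sub⁺ σ a q r)
occursIn-sub⁺ σ (a ⟶ b) (⟶ʳ q) r = ⟶ʳ (occursIn-sub⁺ σ b q r)
occursIn-sub⁺ σ (¬ a)   (¬′ q) r = ¬′ (occursIn-sub⁺ σ a q r)

varSub-sub : ∀ σ {α β} → α varSub β → sub σ α varSub sub σ β
varSub-sub σ {α} {β} α⊆β p with occursIn-sub⁻ σ α p
... | y , q , r = occursIn-sub⁺ σ β (α⊆β q) r

sub-idOn : ∀ σ φ → (∀ {y} → y occursIn φ → σ y ≡ var y) → sub σ φ ≡ φ
sub-idOn σ (var x) σ≗id = σ≗id here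
sub-idOn σ (a ∧ b) σ≗id = cong₂ _∧_ (sub-idOn σ a (λ p → σ≗id (∧ˡ p))) (sub-idOn σ b (λ p → σ≗id (∧ʳ p)))
sub-idOn σ (a ∨ b) σ≗id = cong₂ _∨_ (sub-idOn σ a (λ p → σ≗id (∨ˡ p))) (sub-idOn σ b (λ p → σ≗id (∨ʳ p)))
sub-idOn σ (a ⟶ b) σ≗id = cong₂ _⟶_ (sub-idOn σ a (λ p → σ≗id (⟶ˡ p))) (sub-idOn σ b (λ p → σ≗id (⟶ʳ p)))
sub-idOn σ (¬ a)   σ≗id = cong ¬_ (sub-idOn σ a (λ p → σ≗id (¬′ p)))
sub-idOn σ 𝟘       σ≗id = refl
sub-idOn σ 𝟙       σ≗id = refl

⊢ʳ-sub : ∀ σ {φ} → ∅ ⊢ʳ φ → ∅ ⊢ʳ sub σ φ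
⊢ʳ-sub σ (ax a)          = ax (Axiom-sub σ a)
⊢ʳ-sub σ (mp α⊆β d₁ d₂)  = mp (varSub-sub σ α⊆β) (⊢ʳ-sub σ d₁) (⊢ʳ-sub σ d₂)

collapseOutside : Fm → Subst
collapseOutside β y with y occursIn? β
... | yes _ = var y
... | no _  = 𝟙

collapseOutside-fixes : ∀ β {y} → y occursIn β → collapseOutside β y ≡ var y
collapseOutside-fixes β {y} p with y occursIn? β
... | yes _  = refl
... | no y∉β with () ← y∉β p

collapseOutside-varSub : ∀ β y → collapseOutside β y varSub β
collapseOutside-varSub β y p with y occursIn? β | p
... | yes y∈β | here = y∈β

sub-collapseOutside-varSub : ∀ α β → sub (collapseOutside β) α varSub β
sub-collapseOutside-varSub α β p with occursIn-sub⁻ (collapseOutside β) α p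
... | y , _ , q = collapseOutside-varSub β y q

⊢⇒⊢ʳ : ∀ {φ} → ∅ ⊢ φ → ∅ ⊢ʳ φ
⊢⇒⊢ʳ (ax a) = ax a
⊢⇒⊢ʳ (mp {α} {β} d₁ d₂) =
  mp (sub-collapseOutside-varSub α β) (⊢ʳ-sub σ (⊢⇒⊢ʳ d₁))
     (subst (λ γ → ∅ ⊢ʳ sub σ α ⟶ γ) σβ≡β (⊢ʳ-sub σ (⊢⇒⊢ʳ d₂)))
  where
  σ : Subst
  σ = collapseOutside β

  σβ≡β : sub σ β ≡ β
  σβ≡β = sub-idOn σ β (collapseOutside-fixes β)

Ctx : List Fm → FmSet
Ctx L φ = φ ∈ L

⊢-finite : ∀ {Γ φ} → Γ ⊢ φ → Σ (List Fm) λ L → All Γ L × Ctx L ⊢ φ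
⊢-finite (ax a)      = [] , [] , ax a
⊢-finite (hyp {φ} h) = φ ∷ [] , h ∷ [] , hyp (here refl)
⊢-finite (mp d₁ d₂) with ⊢-finite d₁ | ⊢-finite d₂
... | L₁ , L₁⊆Γ , e₁ | L₂ , L₂⊆Γ , e₂ =
  L₁ ++ L₂ , ++⁺ L₁⊆Γ L₂⊆Γ , mp (⊢-mono ∈-++⁺ˡ e₁) (⊢-mono (∈-++⁺ʳ L₁) e₂)

deduction : ∀ {a L φ} → Ctx (a ∷ L) ⊢ φ → Ctx L ⊢ a ⟶ φ
deduction {a} {φ = φ} (ax x)          = mp (ax x) (ax (A1 φ a))
deduction {a}         (hyp (here refl)) = mp (ax (A1 a a)) (mp (ax (A1 a (a ⟶ a))) (ax (A2 a (a ⟶ a) a)))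
deduction {a} {φ = φ} (hyp (there p))  = mp (hyp p) (ax (A1 φ a))
deduction {a}         (mp {α} {β} d₁ d₂) = mp (deduction d₁) (mp (deduction d₂) (ax (A2 a α β)))

-- L ⟶* φ = aₙ ⟶ … ⟶ a₁ ⟶ φ for L = a₁ ∷ … ∷ aₙ ∷ [], so that the head is discharged first.
_⟶*_ : List Fm → Fm → Fm
[] ⟶* φ      = φ
(a ∷ L) ⟶* φ = L ⟶* (a ⟶ φ)

deduction* : ∀ L {φ} → Ctx L ⊢ φ → ∅ ⊢ L ⟶* φ
deduction* []      d = ⊢-mono (λ ()) d
deduction* (a ∷ L) d = deduction* L (deduction d)

⊢ʳ-discharge : ∀ {Γ} L φ → All (Γ ↾ φ) L → Γ ⊢ʳ L ⟶* φ → Γ ⊢ʳ φ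
⊢ʳ-discharge []      φ []                   d = d
⊢ʳ-discharge {Γ} (a ∷ L) φ ((a∈Γ , a⊆φ) ∷ L⊆Γ) d =
  mp a⊆φ (hyp a∈Γ) (⊢ʳ-discharge L (a ⟶ φ) (All.map weaken L⊆Γ) d)
  where
  weaken : ∀ {γ} → (Γ ↾ φ) γ → (Γ ↾ (a ⟶ φ)) γ
  weaken (γ∈Γ , γ⊆φ) = γ∈Γ , λ p → ⟶ʳ (γ⊆φ p)

theorem4p5 : ∀ (Γ : FmSet) (φ : Fm) → ((Γ ⊢ʳ φ → Γ ⊢ˡ φ) × (Γ ⊢ˡ φ → Γ ⊢ʳ φ))
theorem4p5 Γ φ = restricted⇒leftInclusion , leftInclusion⇒restricted
  where
  restricted⇒leftInclusion : Γ ⊢ʳ φ → Γ ⊢ˡ φ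
  restricted⇒leftInclusion d = Γ ↾ φ , proj₁ , (λ h → proj₂ h) , ⊢ʳ⇒⊢ (⊢ʳ-↾ d (λ p → p))

  leftInclusion⇒restricted : Γ ⊢ˡ φ → Γ ⊢ʳ φ
  leftInclusion⇒restricted (Γ′ , Γ′⊆Γ , Γ′⊆φ , d) with ⊢-finite d
  ... | L , L⊆Γ′ , dL =
    ⊢ʳ-discharge L φ (All.map (λ γ∈Γ′ → Γ′⊆Γ γ∈Γ′ , λ {_} p → Γ′⊆φ γ∈Γ′ p) L⊆Γ′)
      (⊢ʳ-mono (λ ()) (⊢⇒⊢ʳ (deduction* L dL)))
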